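{- If $[\vec s]$ and $[\vec t]$ are basis elements of $\mathcal H_{\mathbb Z}$ of positive depth whose first entries are positive, then $$([\vec s]\sqcup\!\sqcup[\vec t])\sqcup\!\sqcup[0]=[0]\sqcup\!\sqcup([\vec s]\sqcup\!\sqcup[\vec t]).$$
   Context: Let $\mathcal H_{\mathbb Z}$ be the $\mathbb Q$-vector space with basis $\mathbf 1$ together with the formal symbols $[s_1,\dots,s_k]$ for $k\ge1$ and $(s_1,\dots,s_k)\in\mathbb Z^k$. Define linear maps on basis elements of positive depth by $I([s_1,s_2,\dots,s_k])=[s_1+1,s_2,\dots,s_k]$ and $J([s_1,s_2,\dots,s_k])=[s_1-1,s_2,\dots,s_k]$, and set $J(\mathbf 1)=0$. Notation: for a positive-depth basis element, write $[s_1,\dots,s_k]=[s_1,\vec s\,']$, where $[\vec s\,']=[s_2,\dots,s_k]$, or $\mathbf 1$ if $k=1$. For $a\in\mathbb Z$ and $X=\sum c_{\vec v}[\vec v]$, put $[a,X]:=\sum c_{\vec v}[a,\vec v]$, with $[a,\mathbf 1]:=[a]$. The extended shuffle product $\sqcup\!\sqcup$ is the bilinear product with two-sided unit $\mathbf 1$, defined on positive-depth basis elements by the following recursions: <ul> <li>(i) if $s_1=0$: $[0,\vec s\,']\sqcup\!\sqcup[t_1,\vec t\,']=[0,[\vec s\,']\sqcup\!\sqcup[t_1,\vec t\,']]$;</li> <li>(ii) if $s_1>0$ and $t_1=0$: $[s_1,\vec s\,']\sqcup\!\sqcup[0,\vec t\,']=[0,[s_1,\vec s\,']\sqcup\!\sqcup[\vec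 t\,']]$;</li> <li>(iii) if $s_1,t_1>0$: $[s_1,\vec s\,']\sqcup\!\sqcup[t_1,\vec t\,']=I([s_1,\vec s\,']\sqcup\!\sqcup[t_1-1,\vec t\,'])+I([s_1-1,\vec s\,']\sqcup\!\sqcup[t_1,\vec t\,'])$;</li> <li>(iv) if $s_1>0$ and $t_1<0$: $[s_1,\vec s\,']\sqcup\!\sqcup[t_1,\vec t\,']=J([s_1,\vec s\,']\sqcup\!\sqcup[t_1+1,\vec t\,'])-[s_1-1,\vec s\,']\sqcup\!\sqcup[t_1+1,\vec t\,']$;</li> <li>(v) if $s_1<0$: $[s_1,\vec s\,']\sqcup\!\sqcup[t_1,\vec t\,']=J([s_1+1,\vec s\,']\sqcup\!\sqcup[t_1,\vec t\,'])-[s_1+1,\vec s\,']\sqcup\!\sqcup[t_1-1,\vec t\,']$.</li> </ul> The recursions are well founded: (i) and (ii) by induction on total depth, (iii) on $s_1+t_1$, (iv) on $|t_1|$, and (v) on $|s_1|$. -}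

module Defs where

open import Data.Nat using (ℕ; zero; suc)
open import Data.Integer as ℤ using (ℤ; +_; -[1+_]; 0ℤ; 1ℤ)
open import Data.Rational as ℚ using (ℚ; 0ℚ; 1ℚ)
open import Data.List using (List; []; _∷_; map; concatMap; _++_)
open import Data.List.Properties using (≡-dec)
open import Data.Product using (_×_; _,_)
open import Relation.Nullary using (yes; no)
open import Relation.Binary.PropositionalEquality using (_≡_)

-- A basis element is a word of integers; the empty word [] stands for
-- the unit 𝟏, and a non-empty word s₁ ∷ … ∷ sₖ stands for [s₁,…,sₖ].
-- An element of H_Z is a formal finite linear combination, represented
-- as a list of (coefficient , basis word) pairs.  Two such lists
-- represent the same vector iff every basis word has the same total
-- coefficient in both (see _≈_ below).

Word : Set
Word = List ℤ

H : Set
H = List (ℚ × Word)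

⟦_⟧ : Word → H
⟦ w ⟧ = (1ℚ , w) ∷ []

𝟏 : H
𝟏 = ⟦ [] ⟧

_⊕_ : H → H → H
_⊕_ = _++_

scale : ℚ → H → H
scale c = map (λ { (a , w) → (c ℚ.* a , w) })

neg : H → H
neg = scale (ℚ.- 1ℚ)

_⊖_ : H → H → H
X ⊖ Y = X ⊕ neg Y

pre : ℤ → H → H
pre a = map (λ { (c , w) → (c , a ∷ w) })

-- I and J on basis elements (J 𝟏 = 0; I is only ever applied to
-- combinations of positive-depth words, we also send 𝟏 to 0 there)
I : H → H
I [] = []
I ((c , []) ∷ X) = I X
I ((c , s ∷ w) ∷ X) = (c , (s ℤ.+ 1ℤ) ∷ w) ∷ I X

J : H → H
J [] = []
J ((c , []) ∷ X) = J X
J ((c , s ∷ w) ∷ X) = (c , (s ℤ.- 1ℤ) ∷ w) ∷ J X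

coeff : H → Word → ℚ
coeff [] v = 0ℚ
coeff ((c , w) ∷ X) v with ≡-dec ℤ._≟_ w v
... | yes _ = c ℚ.+ coeff X v
... | no  _ = coeff X v

infix 4 _≈_
_≈_ : H → H → Set
X ≈ Y = ∀ v → coeff X v ≡ coeff Y v

-- Inside the module below, f v = [s⃗'] ⧢ v  and  g x = [x , s⃗'] ⧢ [t⃗']
-- are the (already defined) products of smaller total depth, and
-- core x y computes [x , s⃗'] ⧢ [y , t⃗'] following (i)-(v); the
-- recursions (iii)-(v) on the first entries are by recursion on ℕ.

module Core (s t : Word) (f : Word → H) (g : ℤ → H) where

  -- [s₁ , s⃗'] ⧢ [t₁ , t⃗'] with s₁ = m+1, t₁ = n+1  (rule (iii))
  PP : ℕ → ℕ → H
  PP m n = I (A m n) ⊕ I (B m n)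
    where
    -- [m+1 , s⃗'] ⧢ [n , t⃗']
    A : ℕ → ℕ → H
    A m zero    = pre 0ℤ (g (+ suc m))
    A m (suc k) = PP m k
    -- [m , s⃗'] ⧢ [n+1 , t⃗']
    B : ℕ → ℕ → H
    B zero    n = pre 0ℤ (f ((+ suc n) ∷ t))
    B (suc k) n = PP k n

  -- [s₁ , s⃗'] ⧢ [t₁ , t⃗'] with s₁ = m+1, t₁ = -(n+1)  (rule (iv))
  PN : ℕ → ℕ → H
  PN m n = J (C m n) ⊖ D m n
    where
    -- [m+1 , s⃗'] ⧢ [-n , t⃗']
    C : ℕ → ℕ → H
    C m zero    = pre 0ℤ (g (+ suc m))
    C m (suc k) = PN m k
    -- [m , s⃗'] ⧢ [-n , t⃗']
    D : ℕ → ℕ → H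
    D zero    n       = pre 0ℤ (f ((ℤ.- (+ n)) ∷ t))
    D (suc k) zero    = pre 0ℤ (g (+ suc k))
    D (suc k) (suc j) = PN k j

  -- [-m , s⃗'] ⧢ [y , t⃗']  (rule (v), and rule (i) for m = 0)
  N : ℕ → ℤ → H
  N zero    y = pre 0ℤ (f (y ∷ t))
  N (suc m) y = J (N m y) ⊖ N m (y ℤ.- 1ℤ)

  core : ℤ → ℤ → H
  core (+ zero)  y          = pre 0ℤ (f (y ∷ t))
  core (+ suc m) (+ zero)   = pre 0ℤ (g (+ suc m))
  core (+ suc m) (+ suc n)  = PP m n
  core (+ suc m) -[1+ n ]   = PN m n
  core -[1+ m ]  y          = N (suc m) y

shx : ℤ → Word → (Word → H) → Word → H
shx x s f []      = ⟦ x ∷ s ⟧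
shx x s f (y ∷ t) = Core.core s t f (λ x′ → shx x′ s f t) x y

sh : Word → Word → H
sh []      t = ⟦ t ⟧
sh (x ∷ s) t = shx x s (sh s) t

infixl 7 _⧢_
_⧢_ : H → H → H
X ⧢ Y = concatMap (λ { (a , u) → concatMap (λ { (b , v) → scale (a ℚ.* b) (sh u v) }) Y }) X

{-# OPTIONS --safe #-}
-- Rule (iii) builds the product of two words with positive first entries
-- only through I, applied to combinations of words whose first entry is
-- 0 (rules (i), (ii)) or, recursively, positive; so [s⃗] ⧢ [t⃗] is a
-- combination of words with positive first entries.  For such a word u,
-- rule (ii) gives u ⧢ [0] = [0, u], and rule (i) gives [0] ⧢ u = [0, u]
-- for every word u of positive depth.  Both sides therefore equal
-- [0, [s⃗] ⧢ [t⃗]].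
module Submission where

open import Defs
open import Data.Integer using (ℤ; _<_; 0ℤ)
open import Data.List using (_∷_; [])

open import Function using (_∘_)
open import Data.Nat using (zero; suc; z≤n; s≤s)
open import Data.Integer using (+[1+_]; _≤_; +<+)
open import Data.Integer.Properties using (≤-refl; <⇒≤; +-mono-≤-<)
open import Data.Rational as ℚ using (1ℚ)
open import Data.Rational.Properties using (*-identityˡ; *-identityʳ)
open import Data.List using (_++_; concatMap)
open import Data.List.Properties using (++-identityʳ)
open import Data.List.Relation.Unary.All as All using (All; []; _∷_)
open import Data.List.Relation.Unary.All.Properties using (++⁺; map⁺; concat⁺)
open import Data.Product using (_,_; proj₂)
open import Relation.Binary.PropositionalEquality using (_≡_; refl; trans; cong; cong₂; module ≡-Reasoning)

data Leading (P : ℤ → Set) : Word → Set where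
  leading : ∀ {x w} → P x → Leading P (x ∷ w)

InSpan : (Word → Set) → H → Set
InSpan P = All (P ∘ proj₂)

module _ {P : Word → Set} where

  scale-inSpan : ∀ c {X} → InSpan P X → InSpan P (scale c X)
  scale-inSpan c [] = []
  scale-inSpan c (p ∷ ps) = p ∷ scale-inSpan c ps

  ⧢-inSpan : (∀ {u v} → P u → P v → InSpan P (sh u v)) →
             ∀ X Y → InSpan P X → InSpan P Y → InSpan P (X ⧢ Y)
  ⧢-inSpan sh-closed _ _ pX pY =
    concat⁺ (map⁺ (All.map (λ {(a , _)} pu →
      concat⁺ (map⁺ (All.map (λ {(b , _)} pv → scale-inSpan (a ℚ.* b) (sh-closed pu pv)) pY))) pX))

pre-inSpan : ∀ {P a} → P a → ∀ X → InSpan (Leading P) (pre a X)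
pre-inSpan Pa [] = []
pre-inSpan Pa (_ ∷ X) = leading Pa ∷ pre-inSpan Pa X

positive⇒nonNegative : ∀ {X} → InSpan (Leading (0ℤ <_)) X → InSpan (Leading (0ℤ ≤_)) X
positive⇒nonNegative = All.map λ { (leading 0<x) → leading (<⇒≤ 0<x) }

I-inSpan : ∀ X → InSpan (Leading (0ℤ ≤_)) X → InSpan (Leading (0ℤ <_)) (I X)
I-inSpan [] [] = []
I-inSpan ((c , x ∷ w) ∷ X) (leading 0≤x ∷ p) =
  leading (+-mono-≤-< 0≤x (+<+ (s≤s z≤n))) ∷ I-inSpan X p

pre0-nonNegative : ∀ X → InSpan (Leading (0ℤ ≤_)) (pre 0ℤ X)
pre0-nonNegative = pre-inSpan ≤-refl

I⊕I-inSpan : ∀ {X Y} → InSpan (Leading (0ℤ ≤_)) X → InSpan (Leading (0ℤ ≤_)) Y →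
             InSpan (Leading (0ℤ <_)) (I X ⊕ I Y)
I⊕I-inSpan pX pY = ++⁺ (I-inSpan _ pX) (I-inSpan _ pY)

module _ (s t : Word) (f : Word → H) (g : ℤ → H) where
  open Core s t f g

  PP-inSpan      : ∀ m n → InSpan (Leading (0ℤ <_)) (PP m n)
  PP-nonNegative : ∀ m n → InSpan (Leading (0ℤ ≤_)) (PP m n)

  PP-inSpan zero    zero    = I⊕I-inSpan (pre0-nonNegative (g +[1+ 0 ]))
                                         (pre0-nonNegative (f (+[1+ 0 ] ∷ t)))
  PP-inSpan zero    (suc n) = I⊕I-inSpan (PP-nonNegative zero n)
                                         (pre0-nonNegative (f (+[1+ suc n ] ∷ t)))
  PP-inSpan (suc m) zero    = I⊕I-inSpan (pre0-nonNegative (g +[1+ suc m ]))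
                                         (PP-nonNegative m zero)
  PP-inSpan (suc m) (suc n) = I⊕I-inSpan (PP-nonNegative (suc m) n)
                                         (PP-nonNegative m (suc n))

  PP-nonNegative m n = positive⇒nonNegative (PP-inSpan m n)

sh-inSpan : ∀ {u v} → Leading (0ℤ <_) u → Leading (0ℤ <_) v → InSpan (Leading (0ℤ <_)) (sh u v)
sh-inSpan {+[1+ m ] ∷ s} {+[1+ n ] ∷ t} (leading (+<+ (s≤s z≤n))) (leading (+<+ (s≤s z≤n))) =
  PP-inSpan s t (sh s) (λ x → shx x s (sh s) t) m n

sh-[0]ʳ : ∀ {u} → Leading (0ℤ <_) u → sh u (0ℤ ∷ []) ≡ ⟦ 0ℤ ∷ u ⟧
sh-[0]ʳ {+[1+ m ] ∷ s} (leading (+<+ (s≤s z≤n))) = refl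

sh-[0]ˡ : ∀ {P u} → Leading P u → sh (0ℤ ∷ []) u ≡ ⟦ 0ℤ ∷ u ⟧
sh-[0]ˡ (leading _) = refl

⧢-⟦⟧≡pre : ∀ {P v a} → (∀ {u} → P u → sh u v ≡ ⟦ a ∷ u ⟧) →
           ∀ X → InSpan P X → X ⧢ ⟦ v ⟧ ≡ pre a X
⧢-⟦⟧≡pre sh≡ [] [] = refl
⧢-⟦⟧≡pre {a = a} sh≡ ((c , u) ∷ X) (pu ∷ pX) rewrite sh≡ pu =
  cong₂ (λ c′ Y → (c′ , a ∷ u) ∷ Y)
        (trans (*-identityʳ _) (*-identityʳ c)) (⧢-⟦⟧≡pre sh≡ X pX)

⟦⟧-⧢≡pre : ∀ {P v a} → (∀ {u} → P u → sh v u ≡ ⟦ a ∷ u ⟧) →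
           ∀ X → InSpan P X → ⟦ v ⟧ ⧢ X ≡ pre a X
⟦⟧-⧢≡pre {P} {v} {a} sh≡ X pX = trans (++-identityʳ _) (row X pX)
  where
  row : ∀ X → InSpan P X → concatMap (λ { (b , u) → scale (1ℚ ℚ.* b) (sh v u) }) X ≡ pre a X
  row [] [] = refl
  row ((b , u) ∷ X) (pu ∷ pX) rewrite sh≡ pu =
    cong₂ (λ b′ Y → (b′ , a ∷ u) ∷ Y) (trans (*-identityʳ _) (*-identityˡ b)) (row X pX)

corollary2p11 : (s₁ : ℤ) (s′ : Word) (t₁ : ℤ) (t′ : Word) → 0ℤ < s₁ → 0ℤ < t₁ →
    (⟦ s₁ ∷ s′ ⟧ ⧢ ⟦ t₁ ∷ t′ ⟧) ⧢ ⟦ 0ℤ ∷ [] ⟧ ≈ ⟦ 0ℤ ∷ [] ⟧ ⧢ (⟦ s₁ ∷ s′ ⟧ ⧢ ⟦ t₁ ∷ t′ ⟧)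
corollary2p11 s₁ s′ t₁ t′ 0<s₁ 0<t₁ v = cong (λ Y → coeff Y v) (begin
  X ⧢ ⟦ 0ℤ ∷ [] ⟧  ≡⟨ ⧢-⟦⟧≡pre sh-[0]ʳ X X-inSpan ⟩
  pre 0ℤ X         ≡⟨ ⟦⟧-⧢≡pre sh-[0]ˡ X X-inSpan ⟨
  ⟦ 0ℤ ∷ [] ⟧ ⧢ X  ∎)
  where
  open ≡-Reasoning
  X : H
  X = ⟦ s₁ ∷ s′ ⟧ ⧢ ⟦ t₁ ∷ t′ ⟧
  X-inSpan : InSpan (Leading (0ℤ <_)) X
  X-inSpan = ⧢-inSpan sh-inSpan ⟦ s₁ ∷ s′ ⟧ ⟦ t₁ ∷ t′ ⟧ (leading 0<s₁ ∷ []) (leading 0<t₁ ∷ [])
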